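{- Let $L$ and $R$ be two oriented graphs. If $\operatorname{inv}(L) = 1$ and $\operatorname{inv}(R)=2$, then $\operatorname{inv}(L\rightarrow R) = 3$.
   Context: An oriented graph is a digraph with no loops, no multiple arcs and no directed cycle of length 2. Inverting a vertex set $X$ means reversing every arc with both ends in $X$. $\operatorname{inv}(D)$ is the minimum number of successive inversions needed to make the oriented graph $D$ acyclic. The dijoin $L\rightarrow R$ is obtained from the disjoint union of $L$ and $R$ by adding all arcs from $V(L)$ to $V(R)$. -}

module Defs where

open import Data.Nat using (ℕ; zero; suc; _+_; _<_; _≤_)
open import Data.Fin using (Fin; splitAt)
open import Data.Bool using (Bool; true; false; _∧_; not; if_then_else_)
open import Data.Sum using (_⊎_; inj₁; inj₂)
open import Data.List using (List; []; _∷_)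
open import Data.Product using (Σ; ∃; _×_; _,_)
open import Relation.Nullary using (¬_)
open import Relation.Binary.PropositionalEquality using (_≡_)

record Digraph (n : ℕ) : Set where
  constructor mkDigraph
  field
    arc : Fin n → Fin n → Bool
open Digraph public

_⟶[_]_ : {n : ℕ} → Fin n → Digraph n → Fin n → Set
u ⟶[ D ] v = arc D u v ≡ true

IsOriented : {n : ℕ} → Digraph n → Set
IsOriented {n} D =
  ((u : Fin n) → ¬ (u ⟶[ D ] u)) ×
  ((u v : Fin n) → u ⟶[ D ] v → ¬ (v ⟶[ D ] u))

WalkFrom : {n : ℕ} → Digraph n → Fin n → List (Fin n) → Fin n → Set
WalkFrom D u []       last = u ≡ last
WalkFrom D u (w ∷ ws) last = (u ⟶[ D ] w) × WalkFrom D w ws last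

-- A directed cycle: a closed directed walk of positive length,
-- v₀ → v₁ → … → v_k → v₀ (any closed walk contains a directed cycle).
HasDirectedCycle : {n : ℕ} → Digraph n → Set
HasDirectedCycle {n} D =
  Σ (Fin n) λ v → Σ (Fin n) λ w → Σ (List (Fin n)) λ ws →
    (v ⟶[ D ] w) × WalkFrom D w ws v

Acyclic : {n : ℕ} → Digraph n → Set
Acyclic D = ¬ HasDirectedCycle D

Subset : ℕ → Set
Subset n = Fin n → Bool

invert : {n : ℕ} → Subset n → Digraph n → Digraph n
invert X D = mkDigraph λ u v →
  if X u ∧ X v then arc D v u else arc D u v

data Seq (n : ℕ) : ℕ → Set where
  []  : Seq n zero
  _∷_ : {k : ℕ} → Subset n → Seq n k → Seq n (suc k)

applySeq : {n k : ℕ} → Seq n k → Digraph n → Digraph n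
applySeq []       D = D
applySeq (X ∷ Xs) D = applySeq Xs (invert X D)

InvertibleWith : {n : ℕ} → Digraph n → ℕ → Set
InvertibleWith {n} D k = Σ (Seq n k) λ Xs → Acyclic (applySeq Xs D)

InvEq : {n : ℕ} → Digraph n → ℕ → Set
InvEq {n} D k = InvertibleWith D k × ((j : ℕ) → j < k → ¬ InvertibleWith D j)

dijoin : {m n : ℕ} → Digraph m → Digraph n → Digraph (m + n)
dijoin {m} {n} L R = mkDigraph λ u v → go (splitAt m u) (splitAt m v)
  where
  go : Fin m ⊎ Fin n → Fin m ⊎ Fin n → Bool
  go (inj₁ a) (inj₁ b) = arc L a b
  go (inj₁ a) (inj₂ b) = true
  go (inj₂ a) (inj₁ b) = false
  go (inj₂ a) (inj₂ b) = arc R a b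

-- Upper bound: invert L and R separately; no inversion touches an arc between the two
-- sides, and a dijoin of acyclic digraphs is acyclic, so inv(L → R) ≤ inv(L) + inv(R).
-- Lower bound: suppose inverting X₁ and then X₂ makes L → R acyclic.  If X₁ and X₂ agree
-- on V(L), the two inversions cancel on L, so L is acyclic.  Otherwise some a ∈ V(L) lies
-- in exactly one of them.  Every vertex of R is still adjacent to a, and acyclicity
-- forbids arcs from out-neighbours of a to in-neighbours of a; inverting a set with no
-- entering arcs preserves acyclicity, and the in-neighbours of a in R are exactly X₁ ∩ V(R)
-- (if a ∈ X₁ ∖ X₂) or X₂ ∩ V(R) (if a ∈ X₂ ∖ X₁).  In both cases the three inversions
-- compose to a single inversion of R, so inv(R) ≤ 1.
module Submission where

open import Defs
open import Data.Nat using (ℕ; _+_; _≤′_; ≤′-refl; ≤′-step; _<_; s≤s; z≤n)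
open import Data.Nat.Properties using (≤-pred; ≤⇒≤′)
open import Data.Fin using (Fin; splitAt; _↑ˡ_; _↑ʳ_)
open import Data.Fin.Properties using (splitAt-↑ˡ; splitAt-↑ʳ; all?; ¬∀⟶∃¬)
open import Data.Bool using (Bool; true; false; _∧_; not)
open import Data.Bool.Properties using (∧-zeroʳ) renaming (_≟_ to _≟ᵇ_)
open import Data.Sum using (_⊎_; inj₁; inj₂; [_,_]′)
open import Data.List using (List; []; _∷_)
open import Data.Product using (Σ; _×_; _,_; swap)
open import Data.Empty using (⊥; ⊥-elim)
open import Data.Unit using (⊤)
open import Function using (_∘_; id; case_of_)
open import Relation.Nullary using (¬_; yes; no)
open import Relation.Binary.PropositionalEquality using (_≡_; refl; sym; trans)
open import Relation.Binary.Construct.Closure.Transitive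
  using (TransClosure; [_]; _∷_; _++_)

private
  variable
    k m n N : ℕ

_⇝[_]_ : Fin n → Digraph n → Fin n → Set
u ⇝[ D ] v = TransClosure (_⟶[ D ]_) u v

arc∷walk⇒⇝ : {D : Digraph n} {u w v : Fin n} (ws : List (Fin n)) →
  u ⟶[ D ] w → WalkFrom D w ws v → u ⇝[ D ] v
arc∷walk⇒⇝ []       u⟶w refl         = [ u⟶w ]
arc∷walk⇒⇝ (x ∷ xs) u⟶w (w⟶x , walk) = u⟶w ∷ arc∷walk⇒⇝ xs w⟶x walk

⇝⇒arc∷walk : {D : Digraph n} {u v : Fin n} → u ⇝[ D ] v →
  Σ (Fin n) λ w → Σ (List (Fin n)) λ ws → (u ⟶[ D ] w) × WalkFrom D w ws v
⇝⇒arc∷walk {v = v} [ u⟶v ] = v , [] , u⟶v , refl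
⇝⇒arc∷walk (_∷_ {y = w} u⟶w w⇝v) with ⇝⇒arc∷walk w⇝v
... | x , xs , w⟶x , walk = w , x ∷ xs , u⟶w , w⟶x , walk

Acyclic⇒¬⇝ : {D : Digraph n} → Acyclic D → {v : Fin n} → ¬ v ⇝[ D ] v
Acyclic⇒¬⇝ acyclic {v} v⇝v = acyclic (v , ⇝⇒arc∷walk v⇝v)

¬⇝⇒Acyclic : {D : Digraph n} → ({v : Fin n} → ¬ v ⇝[ D ] v) → Acyclic D
¬⇝⇒Acyclic no-cycle (v , w , ws , v⟶w , walk) = no-cycle (arc∷walk⇒⇝ ws v⟶w walk)

⇝-map : {E : Digraph k} {D : Digraph N} (f : Fin k → Fin N) →
  (∀ {a b} → a ⟶[ E ] b → f a ⟶[ D ] f b) →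
  ∀ {a b} → a ⇝[ E ] b → f a ⇝[ D ] f b
⇝-map f hom [ a⟶b ]     = [ hom a⟶b ]
⇝-map f hom (a⟶c ∷ c⇝b) = hom a⟶c ∷ ⇝-map f hom c⇝b

Acyclic-hom : {E : Digraph k} {D : Digraph N} (f : Fin k → Fin N) →
  (∀ {a b} → a ⟶[ E ] b → f a ⟶[ D ] f b) → Acyclic D → Acyclic E
Acyclic-hom f hom acyclic = ¬⇝⇒Acyclic (Acyclic⇒¬⇝ acyclic ∘ ⇝-map f hom)

_≐_ : Digraph n → Digraph n → Set
G ≐ H = ∀ u v → arc G u v ≡ arc H u v

≐-sym : {G H : Digraph n} → G ≐ H → H ≐ G
≐-sym G≐H u v = sym (G≐H u v)

≐-trans : {F G H : Digraph n} → F ≐ G → G ≐ H → F ≐ H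
≐-trans F≐G G≐H u v = trans (F≐G u v) (G≐H u v)

Acyclic-resp-≐ : {G H : Digraph n} → G ≐ H → Acyclic H → Acyclic G
Acyclic-resp-≐ G≐H = Acyclic-hom id (λ {u} {v} u⟶v → trans (sym (G≐H u v)) u⟶v)

invert-cong : (X : Subset n) {G H : Digraph n} → G ≐ H → invert X G ≐ invert X H
invert-cong X G≐H u v with X u ∧ X v
... | true  = G≐H v u
... | false = G≐H u v

applySeq-cong : (Xs : Seq n k) {G H : Digraph n} → G ≐ H → applySeq Xs G ≐ applySeq Xs H
applySeq-cong []       G≐H = G≐H
applySeq-cong (X ∷ Xs) G≐H = applySeq-cong Xs (invert-cong X G≐H)

invert-involutive : {X Y : Subset n} → (∀ u → X u ≡ Y u) → (G : Digraph n) →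
  invert Y (invert X G) ≐ G
invert-involutive {X = X} X≗Y G u v rewrite sym (X≗Y u) | sym (X≗Y v) with X u | X v
... | true  | true  = refl
... | true  | false = refl
... | false | _     = refl

invert-sandwich : (A B : Subset n) (G : Digraph n) →
  invert A (invert B (invert A G)) ≐ invert B G
invert-sandwich A B G u v with A u | A v | B u | B v
... | true  | true  | true  | true  = refl
... | true  | true  | true  | false = refl
... | true  | true  | false | true  = refl
... | true  | true  | false | false = refl
... | true  | false | _     | _     = refl
... | false | true  | _     | _     = refl
... | false | false | _     | _     = refl

InvertibleWith-mono : {D : Digraph n} {j k : ℕ} → j ≤′ k → InvertibleWith D j → InvertibleWith D k
InvertibleWith-mono ≤′-refl           invertible = invertible
InvertibleWith-mono (≤′-step j≤′k) invertible with InvertibleWith-mono j≤′k invertible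
... | Xs , acyclic = (λ _ → false) ∷ Xs , acyclic   -- inverting ∅ is definitionally the identity

module _ (G : Digraph n) (S : Subset n) where

  private
    Reach : Bool → Bool → Fin n → Fin n → Set
    Reach true  true  u v = v ⇝[ G ] u
    Reach true  false u v = ⊤
    Reach false true  u v = ⊥
    Reach false false u v = u ⇝[ G ] v

    Reach-trans : ∀ s t r {u w v} → Reach s t u w → Reach t r w v → Reach s r u v
    Reach-trans true  true  true  u⇜w w⇜v = w⇜v ++ u⇜w
    Reach-trans true  true  false _   _   = _
    Reach-trans true  false true  _   ()
    Reach-trans true  false false _   _   = _
    Reach-trans false true  _     ()  _
    Reach-trans false false true  _   ()
    Reach-trans false false false u⇝w w⇝v = u⇝w ++ w⇝v

  invert-no-entry-acyclic : (∀ {u v} → S u ≡ false → S v ≡ true → ¬ u ⟶[ G ] v) →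
    Acyclic G → Acyclic (invert S G)
  invert-no-entry-acyclic no-entry acyclic = ¬⇝⇒Acyclic no-cycle
    where
    arc⇒Reach : ∀ {u v} → u ⟶[ invert S G ] v → Reach (S u) (S v) u v
    arc⇒Reach {u} {v} u⟶v with S u in Su | S v in Sv
    ... | true  | true  = [ u⟶v ]
    ... | true  | false = _
    ... | false | true  = no-entry Su Sv u⟶v
    ... | false | false = [ u⟶v ]

    ⇝⇒Reach : ∀ {u v} → u ⇝[ invert S G ] v → Reach (S u) (S v) u v
    ⇝⇒Reach [ u⟶v ]              = arc⇒Reach u⟶v
    ⇝⇒Reach (_∷_ {y = w} u⟶w w⇝v) = Reach-trans _ (S w) _ (arc⇒Reach u⟶w) (⇝⇒Reach w⇝v)

    no-cycle : ∀ {v} → ¬ v ⇝[ invert S G ] v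
    no-cycle {v} v⇝v with S v | ⇝⇒Reach v⇝v
    ... | true  | v⇜v = Acyclic⇒¬⇝ acyclic v⇜v
    ... | false | v⇝v = Acyclic⇒¬⇝ acyclic v⇝v

restrict : (Fin k → Fin N) → Digraph N → Digraph k
restrict f D = mkDigraph λ a b → arc D (f a) (f b)

Acyclic-restrict : (f : Fin k → Fin N) {D : Digraph N} → Acyclic D → Acyclic (restrict f D)
Acyclic-restrict f = Acyclic-hom f id

Orients : Digraph n → Bool → Fin n → Fin n → Set
Orients G s x y = (arc G x y ≡ not s) × (arc G y x ≡ s)

Orients-invert-∌ : {s : Bool} {x y : Fin n} (X : Subset n) (G : Digraph n) →
  X x ≡ false → Orients G s x y → Orients (invert X G) s x y
Orients-invert-∌ {y = y} X G Xx orients rewrite Xx | ∧-zeroʳ (X y) = orients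

Orients-invert-∋ : {x y : Fin n} (X : Subset n) (G : Digraph n) →
  X x ≡ true → Orients G false x y → Orients (invert X G) (X y) x y
Orients-invert-∋ {y = y} X G Xx orients rewrite Xx with X y
... | true  = swap orients
... | false = orients

-- An arc entering the in-neighbours of c from its out-neighbours would close a directed
-- triangle through c.
Acyclic-invert-inNeighbours : {G : Digraph N} (f : Fin k → Fin N) (c : Fin N) (S : Subset k) →
  (∀ u → Orients G (S u) c (f u)) → Acyclic G → Acyclic (invert S (restrict f G))
Acyclic-invert-inNeighbours {G = G} f c S orients acyclic =
  invert-no-entry-acyclic (restrict f G) S no-entry (Acyclic-restrict f acyclic)
  where
  no-entry : ∀ {u v} → S u ≡ false → S v ≡ true → ¬ u ⟶[ restrict f G ] v
  no-entry {u} {v} Su Sv u⟶v = Acyclic⇒¬⇝ acyclic (c⟶u ∷ u⟶v ∷ [ v⟶c ])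
    where
    c⟶u : c ⟶[ G ] f u
    c⟶u with orients u
    ... | c⟶u , _ rewrite Su = c⟶u
    v⟶c : f v ⟶[ G ] c
    v⟶c with orients v
    ... | _ , v⟶c rewrite Sv = v⟶c

mapSeq : (Subset n → Subset N) → Seq n k → Seq N k
mapSeq f []       = []
mapSeq f (X ∷ Xs) = f X ∷ mapSeq f Xs

_++ˢ_ : {i j : ℕ} → Seq n i → Seq n j → Seq n (i + j)
[]       ++ˢ Ys = Ys
(X ∷ Xs) ++ˢ Ys = X ∷ (Xs ++ˢ Ys)

applySeq-++ˢ : {i j : ℕ} (Xs : Seq n i) (Ys : Seq n j) (D : Digraph n) →
  applySeq (Xs ++ˢ Ys) D ≡ applySeq Ys (applySeq Xs D)
applySeq-++ˢ []       Ys D = refl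
applySeq-++ˢ (X ∷ Xs) Ys D = applySeq-++ˢ Xs Ys (invert X D)

module _ {m n : ℕ} where

  liftˡ : Subset m → Subset (m + n)
  liftˡ X = [ X , (λ _ → false) ]′ ∘ splitAt m

  liftʳ : Subset n → Subset (m + n)
  liftʳ Y = [ (λ _ → false) , Y ]′ ∘ splitAt m

  module _ (L : Digraph m) (R : Digraph n) where

    dijoin-restrictˡ : restrict (_↑ˡ n) (dijoin L R) ≐ L
    dijoin-restrictˡ a b rewrite splitAt-↑ˡ m a n | splitAt-↑ˡ m b n = refl

    dijoin-restrictʳ : restrict (m ↑ʳ_) (dijoin L R) ≐ R
    dijoin-restrictʳ a b rewrite splitAt-↑ʳ m n a | splitAt-↑ʳ m n b = refl

    dijoin-Orients : ∀ a b → Orients (dijoin L R) false (a ↑ˡ n) (m ↑ʳ b)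
    dijoin-Orients a b rewrite splitAt-↑ˡ m a n | splitAt-↑ʳ m n b = refl , refl

    invert-liftˡ-dijoin : (X : Subset m) → invert (liftˡ X) (dijoin L R) ≐ dijoin (invert X L) R
    invert-liftˡ-dijoin X u v with splitAt m u | splitAt m v
    ... | inj₁ a | inj₁ b = refl
    ... | inj₁ a | inj₂ b rewrite ∧-zeroʳ (X a) = refl
    ... | inj₂ a | inj₁ b = refl
    ... | inj₂ a | inj₂ b = refl

    invert-liftʳ-dijoin : (Y : Subset n) → invert (liftʳ Y) (dijoin L R) ≐ dijoin L (invert Y R)
    invert-liftʳ-dijoin Y u v with splitAt m u | splitAt m v
    ... | inj₁ a | inj₁ b = refl
    ... | inj₁ a | inj₂ b = refl
    ... | inj₂ a | inj₁ b rewrite ∧-zeroʳ (Y a) = refl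
    ... | inj₂ a | inj₂ b = refl

    private
      Reach : Fin m ⊎ Fin n → Fin m ⊎ Fin n → Set
      Reach (inj₁ a) (inj₁ b) = a ⇝[ L ] b
      Reach (inj₁ a) (inj₂ b) = ⊤
      Reach (inj₂ a) (inj₁ b) = ⊥
      Reach (inj₂ a) (inj₂ b) = a ⇝[ R ] b

      Reach-trans : ∀ x y z → Reach x y → Reach y z → Reach x z
      Reach-trans (inj₁ a) (inj₁ c) (inj₁ b) a⇝c c⇝b = a⇝c ++ c⇝b
      Reach-trans (inj₁ a) (inj₁ c) (inj₂ b) _   _   = _
      Reach-trans (inj₁ a) (inj₂ c) (inj₁ b) _   ()
      Reach-trans (inj₁ a) (inj₂ c) (inj₂ b) _   _   = _
      Reach-trans (inj₂ a) (inj₁ c) _        ()  _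
      Reach-trans (inj₂ a) (inj₂ c) (inj₁ b) _   ()
      Reach-trans (inj₂ a) (inj₂ c) (inj₂ b) a⇝c c⇝b = a⇝c ++ c⇝b

      arc⇒Reach : ∀ {u v} → u ⟶[ dijoin L R ] v → Reach (splitAt m u) (splitAt m v)
      arc⇒Reach {u} {v} u⟶v with splitAt m u | splitAt m v
      ... | inj₁ a | inj₁ b = [ u⟶v ]
      ... | inj₁ a | inj₂ b = _
      ... | inj₂ a | inj₁ b = case u⟶v of λ ()
      ... | inj₂ a | inj₂ b = [ u⟶v ]

      ⇝⇒Reach : ∀ {u v} → u ⇝[ dijoin L R ] v → Reach (splitAt m u) (splitAt m v)
      ⇝⇒Reach [ u⟶v ]              = arc⇒Reach u⟶v
      ⇝⇒Reach (_∷_ {y = w} u⟶w w⇝v) = Reach-trans _ (splitAt m w) _ (arc⇒Reach u⟶w) (⇝⇒Reach w⇝v)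

    dijoin-acyclic : Acyclic L → Acyclic R → Acyclic (dijoin L R)
    dijoin-acyclic acyclicL acyclicR = ¬⇝⇒Acyclic no-cycle
      where
      no-cycle : ∀ {v} → ¬ v ⇝[ dijoin L R ] v
      no-cycle {v} v⇝v with splitAt m v | ⇝⇒Reach v⇝v
      ... | inj₁ a | a⇝a = Acyclic⇒¬⇝ acyclicL a⇝a
      ... | inj₂ b | b⇝b = Acyclic⇒¬⇝ acyclicR b⇝b

applySeq-liftˡ-dijoin : {m n k : ℕ} (Xs : Seq m k) (L : Digraph m) (R : Digraph n) →
  applySeq (mapSeq (liftˡ {n = n}) Xs) (dijoin L R) ≐ dijoin (applySeq Xs L) R
applySeq-liftˡ-dijoin []       L R u v = refl
applySeq-liftˡ-dijoin (X ∷ Xs) L R =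
  ≐-trans (applySeq-cong (mapSeq liftˡ Xs) (invert-liftˡ-dijoin L R X))
          (applySeq-liftˡ-dijoin Xs (invert X L) R)

applySeq-liftʳ-dijoin : {m n k : ℕ} (Ys : Seq n k) (L : Digraph m) (R : Digraph n) →
  applySeq (mapSeq (liftʳ {m}) Ys) (dijoin L R) ≐ dijoin L (applySeq Ys R)
applySeq-liftʳ-dijoin []       L R u v = refl
applySeq-liftʳ-dijoin (Y ∷ Ys) L R =
  ≐-trans (applySeq-cong (mapSeq liftʳ Ys) (invert-liftʳ-dijoin L R Y))
          (applySeq-liftʳ-dijoin Ys L (invert Y R))

dijoin-InvertibleWith-+ : {m n i j : ℕ} {L : Digraph m} {R : Digraph n} →
  InvertibleWith L i → InvertibleWith R j → InvertibleWith (dijoin L R) (i + j)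
dijoin-InvertibleWith-+ {m} {n} {L = L} {R} (Xs , acyclicL) (Ys , acyclicR) =
  mapSeq (liftˡ {n = n}) Xs ++ˢ mapSeq (liftʳ {m}) Ys , acyclic
  where
  inverted : applySeq (mapSeq (liftʳ {m}) Ys) (applySeq (mapSeq (liftˡ {n = n}) Xs) (dijoin L R))
           ≐ dijoin (applySeq Xs L) (applySeq Ys R)
  inverted = ≐-trans (applySeq-cong (mapSeq (liftʳ {m}) Ys) (applySeq-liftˡ-dijoin Xs L R))
                     (applySeq-liftʳ-dijoin Ys (applySeq Xs L) R)

  acyclic : Acyclic (applySeq (mapSeq (liftˡ {n = n}) Xs ++ˢ mapSeq (liftʳ {m}) Ys) (dijoin L R))
  acyclic rewrite applySeq-++ˢ (mapSeq (liftˡ {n = n}) Xs) (mapSeq (liftʳ {m}) Ys) (dijoin L R) =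
    Acyclic-resp-≐ inverted (dijoin-acyclic _ _ acyclicL acyclicR)

module _ {m n : ℕ} (L : Digraph m) (R : Digraph n) (X₁ X₂ : Subset (m + n))
         (acyclic : Acyclic (invert X₂ (invert X₁ (dijoin L R)))) where

  private
    ιˡ : Fin m → Fin (m + n)
    ιˡ a = a ↑ˡ n

    ιʳ : Fin n → Fin (m + n)
    ιʳ b = m ↑ʳ b

    D₂ : Digraph (m + n)
    D₂ = invert X₂ (invert X₁ (dijoin L R))

    restrictʳ-D₂ : restrict ιʳ D₂ ≐ invert (X₂ ∘ ιʳ) (invert (X₁ ∘ ιʳ) R)
    restrictʳ-D₂ = invert-cong (X₂ ∘ ιʳ) (invert-cong (X₁ ∘ ιʳ) (dijoin-restrictʳ L R))

  agreeˡ⇒acyclicˡ : (∀ a → X₁ (ιˡ a) ≡ X₂ (ιˡ a)) → Acyclic L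
  agreeˡ⇒acyclicˡ X₁≗X₂ = Acyclic-resp-≐ (≐-sym restrictˡ-D₂) (Acyclic-restrict ιˡ acyclic)
    where
    restrictˡ-D₂ : restrict ιˡ D₂ ≐ L
    restrictˡ-D₂ = ≐-trans (invert-cong (X₂ ∘ ιˡ) (invert-cong (X₁ ∘ ιˡ) (dijoin-restrictˡ L R)))
                           (invert-involutive X₁≗X₂ L)

  ∈X₁∖X₂⇒acyclicʳ : (a : Fin m) → X₁ (ιˡ a) ≡ true → X₂ (ιˡ a) ≡ false →
    Acyclic (invert (X₂ ∘ ιʳ) R)
  ∈X₁∖X₂⇒acyclicʳ a X₁a X₂a = Acyclic-resp-≐ inverted
    (Acyclic-invert-inNeighbours ιʳ (ιˡ a) (X₁ ∘ ιʳ) orients acyclic)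
    where
    orients : ∀ u → Orients D₂ (X₁ (ιʳ u)) (ιˡ a) (ιʳ u)
    orients u = Orients-invert-∌ X₂ (invert X₁ (dijoin L R)) X₂a
                  (Orients-invert-∋ X₁ (dijoin L R) X₁a (dijoin-Orients L R a u))

    inverted : invert (X₂ ∘ ιʳ) R ≐ invert (X₁ ∘ ιʳ) (restrict ιʳ D₂)
    inverted = ≐-trans (≐-sym (invert-sandwich (X₁ ∘ ιʳ) (X₂ ∘ ιʳ) R))
                       (invert-cong (X₁ ∘ ιʳ) (≐-sym restrictʳ-D₂))

  ∈X₂∖X₁⇒acyclicʳ : (a : Fin m) → X₁ (ιˡ a) ≡ false → X₂ (ιˡ a) ≡ true →
    Acyclic (invert (X₁ ∘ ιʳ) R)
  ∈X₂∖X₁⇒acyclicʳ a X₁a X₂a = Acyclic-resp-≐ inverted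
    (Acyclic-invert-inNeighbours ιʳ (ιˡ a) (X₂ ∘ ιʳ) orients acyclic)
    where
    orients : ∀ u → Orients D₂ (X₂ (ιʳ u)) (ιˡ a) (ιʳ u)
    orients u = Orients-invert-∋ X₂ (invert X₁ (dijoin L R)) X₂a
                  (Orients-invert-∌ X₁ (dijoin L R) X₁a (dijoin-Orients L R a u))

    inverted : invert (X₁ ∘ ιʳ) R ≐ invert (X₂ ∘ ιʳ) (restrict ιʳ D₂)
    inverted = ≐-trans (≐-sym (invert-involutive {X = X₂ ∘ ιʳ} (λ _ → refl) (invert (X₁ ∘ ιʳ) R)))
                       (invert-cong (X₂ ∘ ιʳ) (≐-sym restrictʳ-D₂))

dijoin-InvertibleWith-2 : {L : Digraph m} {R : Digraph n} →
  InvertibleWith (dijoin L R) 2 → InvertibleWith L 0 ⊎ InvertibleWith R 1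
dijoin-InvertibleWith-2 {m} {n} {L} {R} (X₁ ∷ X₂ ∷ [] , acyclic)
  with all? (λ a → X₁ (a ↑ˡ n) ≟ᵇ X₂ (a ↑ˡ n))
... | yes X₁≗X₂ = inj₁ ([] , agreeˡ⇒acyclicˡ L R X₁ X₂ acyclic X₁≗X₂)
... | no X₁≭X₂ with ¬∀⟶∃¬ m _ (λ a → X₁ (a ↑ˡ n) ≟ᵇ X₂ (a ↑ˡ n)) X₁≭X₂
... | a , X₁a≢X₂a with X₁ (a ↑ˡ n) in X₁a | X₂ (a ↑ˡ n) in X₂a
... | true  | true  = ⊥-elim (X₁a≢X₂a refl)
... | true  | false = inj₂ ((X₂ ∘ (m ↑ʳ_)) ∷ [] , ∈X₁∖X₂⇒acyclicʳ L R X₁ X₂ acyclic a X₁a X₂a)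
... | false | true  = inj₂ ((X₁ ∘ (m ↑ʳ_)) ∷ [] , ∈X₂∖X₁⇒acyclicʳ L R X₁ X₂ acyclic a X₁a X₂a)
... | false | false = ⊥-elim (X₁a≢X₂a refl)

theorem3p4 : {m n : ℕ} (L : Digraph m) (R : Digraph n) →
    IsOriented L → IsOriented R →
    InvEq L 1 → InvEq R 2 → InvEq (dijoin L R) 3
theorem3p4 L R _ _ (invertibleL , minimalL) (invertibleR , minimalR) =
  dijoin-InvertibleWith-+ invertibleL invertibleR , minimal
  where
  minimal : (j : ℕ) → j < 3 → ¬ InvertibleWith (dijoin L R) j
  minimal j j<3 invertible =
    [ minimalL 0 (s≤s z≤n) , minimalR 1 (s≤s (s≤s z≤n)) ]′
      (dijoin-InvertibleWith-2 (InvertibleWith-mono (≤⇒≤′ (≤-pred j<3)) invertible))
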